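{- Let $R=(V^l\cup V^r\cup\{s,t\},E)$ be an $st$-polygon and let $P$ be an acyclic HP-completion set for $R$ with $|P|=2\mu$ for some integer $\mu\ge1$. Then there exists another acyclic HP-completion set $P'$ for $R$ with $|P'|=2$ such that the edges of $P'$ create at most as many crossings with the edges of $R$ as the edges of $P$ do. In addition, the hamiltonian paths induced by $P$ and $P'$ have the same first edge and the same last edge.
   Context: An $st$-digraph is a finite acyclic digraph with exactly one source $s$ and one sink $t$. An outerplanar $st$-digraph is an $st$-digraph with a fixed upward planar embedding with all vertices on the external face; its boundary consists of two directed paths from $s$ to $t$, the left side (inner vertices $V^l$) and the right side (inner vertices $V^r$). An $st$-polygon is an outerplanar $st$-digraph with $V^l\neq\emptyset$, $V^r\neq\emptyset$ and no edge between $V^l$ and $V^r$ (it may contain the edge $(s,t)$ drawn in the interior). An acyclic HP-completion set of $R=(V,E)$ is a set $E_c$ of new directed edges such that $(V,E\cup E_c)$ is acyclic and has a hamiltonian path from $s$ to $t$ that uses all edges of $E_c$ (the induced hamiltonian path). The number of crossings created by $E_c$ with the edges of $R$ is the minimum number of crossings over drawings of $(V,E\cup E_c)$ preserving the embedding of $R$. -}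

module Defs where

open import Data.Nat using (ℕ; zero; suc; _+_; _∸_; _≤_; _<ᵇ_; _≡ᵇ_)
open import Data.Nat.ListAction using (sum)
open import Data.Fin using (Fin; toℕ; inject₁; fromℕ) renaming (zero to fzero; suc to fsuc)
open import Data.Bool using (Bool; true; false; _∧_; _∨_; not; _xor_)
open import Data.List using (List; []; _∷_; _++_; length; map; filterᵇ; head; last)
open import Data.List.Membership.Propositional using (_∈_; _∉_)
open import Data.List.Relation.Unary.All using (All)
open import Data.List.Relation.Unary.Unique.Propositional using (Unique)
open import Data.Maybe using (Maybe; just)
open import Data.Product using (_×_; _,_; ∃-syntax; proj₁; proj₂)
open import Data.Empty using (⊥)
open import Relation.Nullary using (¬_)
open import Relation.Binary.PropositionalEquality using (_≡_; _≢_)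
open import Relation.Binary.Construct.Closure.Transitive using (TransClosure)

-- Vertices of an st-polygon with left inner vertices l_0 … l_m
-- (|V^l| = suc m ≥ 1) and right inner vertices r_0 … r_n (|V^r| = suc n ≥ 1).

data Vtx (m n : ℕ) : Set where
  s t : Vtx m n
  L   : Fin (suc m) → Vtx m n
  R   : Fin (suc n) → Vtx m n

Edge : ℕ → ℕ → Set
Edge m n = Vtx m n × Vtx m n   -- directed edge (tail , head)

Adj : ∀ {m n} → List (Edge m n) → Vtx m n → Vtx m n → Set
Adj es u v = (u , v) ∈ es

Acyclic : ∀ {m n} → List (Edge m n) → Set
Acyclic {m} {n} es = ∀ (v : Vtx m n) → ¬ TransClosure (Adj es) v v

IsStDigraph : ∀ {m n} → List (Edge m n) → Set
IsStDigraph {m} {n} es =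
  Acyclic es
  × (∀ (u : Vtx m n) → (u , s) ∉ es)
  × (∀ (v : Vtx m n) → v ≢ s → ∃[ u ] ((u , v) ∈ es))
  × (∀ (v : Vtx m n) → (t , v) ∉ es)
  × (∀ (u : Vtx m n) → u ≢ t → ∃[ v ] ((u , v) ∈ es))

-- The fixed outerplanar embedding: all vertices on a circle in the
-- cyclic order  s, l_0, …, l_m, t, r_n, …, r_0  (boundary = left path
-- followed by reversed right path); every edge is drawn as a straight
-- chord inside the circle.

pos : ∀ {m n} → Vtx m n → ℕ
pos s = 0
pos {m} t = suc (suc m)
pos (L i) = suc (toℕ i)
pos {m} {n} (R j) = suc (suc m) + (suc n ∸ toℕ j)

btw : ℕ → ℕ → ℕ → Bool
btw x y z = ((x <ᵇ z) ∧ (z <ᵇ y)) ∨ ((y <ᵇ z) ∧ (z <ᵇ x))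

-- the chords e and f cross (their endpoints strictly interleave on the circle)
crossᵇ : ∀ {m n} → Edge m n → Edge m n → Bool
crossᵇ (a , b) (c , d) =
  let pa = pos a ; pb = pos b ; pc = pos c ; pd = pos d
      endpt = λ z → (z ≡ᵇ pa) ∨ (z ≡ᵇ pb)
  in not (endpt pc) ∧ not (endpt pd) ∧ (btw pa pb pc xor btw pa pb pd)

IsStPolygon : (m n : ℕ) → List (Edge m n) → Set
IsStPolygon m n E =
  Unique E
  × IsStDigraph E
  × ((s , L fzero) ∈ E)
  × (∀ (i : Fin m) → (L (inject₁ i) , L (fsuc i)) ∈ E)
  × ((L (fromℕ m) , t) ∈ E)
  × ((s , R fzero) ∈ E)
  × (∀ (j : Fin n) → (R (inject₁ j) , R (fsuc j)) ∈ E)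
  × ((R (fromℕ n) , t) ∈ E)
  × (∀ (i : Fin (suc m)) (j : Fin (suc n)) → (L i , R j) ∉ E × (R j , L i) ∉ E)
  -- outerplanarity of the fixed embedding: no two edges cross
  × (∀ e f → e ∈ E → f ∈ E → crossᵇ e f ≡ false)

steps : ∀ {A : Set} → List A → List (A × A)
steps [] = []
steps (x ∷ []) = []
steps (x ∷ y ∷ xs) = (x , y) ∷ steps (y ∷ xs)

InducedHP : ∀ {m n} → List (Edge m n) → List (Edge m n) → List (Vtx m n) → Set
InducedHP {m} {n} E P π =
  Unique π
  × (∀ (v : Vtx m n) → v ∈ π)
  × head π ≡ just s
  × last π ≡ just t
  × All (λ e → e ∈ E ++ P) (steps π)
  × All (λ e → e ∈ steps π) P

IsAcyclicHPCompletion : ∀ {m n} → List (Edge m n) → List (Edge m n) → Set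
IsAcyclicHPCompletion E P =
  Unique P
  × All (λ e → e ∉ E) P
  × Acyclic (E ++ P)
  × ∃[ π ] InducedHP E P π

-- A new edge e is drawn inside the polygon; the minimum
-- number of edges of R it must cross is the number of edges of R
-- whose endpoints strictly interleave with those of e.  The crossings
-- of a completion set are summed over its edges (crossings among new
-- edges are not counted).

edgeCrossings : ∀ {m n} → List (Edge m n) → Edge m n → ℕ
edgeCrossings E e = length (filterᵇ (crossᵇ e) E)

crossings : ∀ {m n} → List (Edge m n) → List (Edge m n) → ℕ
crossings E P = sum (map (edgeCrossings E) P)

-- Along an induced hamiltonian path the steps that change side (between V^l and V^r) are exactly
-- the edges of P: a step inside one side is forced to be a boundary edge, since skipping a vertex
-- of the side would close a cycle. So when |P| is even the path leaves s and enters t on the same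
-- side V. Let w₀ and w_k be the first and last vertices of the other side W, let v_a be the
-- predecessor of w₀ on the path, w_b the predecessor of v_{a+1} and v_c the successor of w_k.
-- Then P′ = {(v_a, w₀), (w_k, v_{a+1})} induces the path s, v₀ … v_a, w₀ … w_k, v_{a+1} … , t,
-- whose order is a topological order of R ∪ P′. Every edge of R has a whole side of the polygon
-- on one side of it, so an edge crossing (w_k, v_{a+1}) also crosses (w_b, v_{a+1}) or
-- (w_k, v_c); hence P′ creates no more crossings than P. Finally an edge of P entering w₀ from V
-- and one leaving w_k into V force every induced path to begin with (s, v₀) and end with
-- (v_last, t), for P and P′ alike.

module Submission where

open import Data.Bool using (Bool; true; false; not; _xor_; T)
open import Data.Bool.Properties using (not-involutive; xor-same; T-≡)
open import Data.Empty using (⊥; ⊥-elim)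
open import Data.Fin using (Fin; toℕ; inject₁; fromℕ) renaming (zero to fzero; suc to fsuc)
open import Data.Fin.Properties
  using (toℕ-injective; toℕ-inject₁; toℕ-fromℕ; toℕ<n; toℕ≤pred[n]; fromℕ≢inject₁) renaming (_≟_ to _≟ᶠ_)
open import Data.List using (List; []; _∷_; _++_; length; map; filterᵇ; head; last)
open import Data.List.Properties using (map-++; length-++)
open import Data.List.Membership.Propositional using (_∈_; _∉_)
open import Data.List.Membership.Propositional.Properties
  using (∈-∃++; ∈-++⁺ˡ; ∈-++⁺ʳ; ∈-++⁻; ∈-filter⁺; ∈-filter⁻)
open import Data.List.Relation.Binary.Permutation.Propositional using (_↭_; prep; ↭-refl; ↭-trans)
open import Data.List.Relation.Binary.Permutation.Propositional.Properties
  using (shift; ↭-length) renaming (map⁺ to ↭-map⁺)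
open import Data.List.Relation.Binary.Subset.Propositional using (_⊆_)
open import Data.List.Relation.Unary.All as All using (All; []; _∷_)
open import Data.List.Relation.Unary.All.Properties using (All¬⇒¬Any)
open import Data.List.Relation.Unary.AllPairs as AllPairs using (AllPairs; []; _∷_)
open import Data.List.Relation.Unary.Any using (here; there)
open import Data.List.Relation.Unary.Linked as Linked using (Linked; []; [-]; _∷_)
open import Data.List.Relation.Unary.Linked.Properties using (Linked⇒AllPairs; ++⁺)
open import Data.List.Relation.Unary.Unique.Propositional using (Unique)
open import Data.List.Relation.Unary.Unique.Propositional.Properties using (filter⁺)
open import Data.Maybe using (just)
open import Data.Maybe.Relation.Binary.Connected using (Connected; just)
open import Data.Nat using (ℕ; zero; suc; _+_; _*_; _≤_; _<_; z≤n; s≤s; z<s; _<ᵇ_; _≡ᵇ_)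
open import Data.Nat.ListAction using (sum)
open import Data.Nat.ListAction.Properties using (sum-++; sum-↭)
open import Data.Nat.Properties
open import Data.Product using (_×_; _,_; ∃-syntax; proj₁; proj₂)
open import Data.Sum as Sum using (_⊎_; inj₁; inj₂)
open import Function using (_∘_; Equivalence)
open import Relation.Binary.Construct.Closure.Transitive using (TransClosure; [_]; _∷_) renaming (_++_ to _⁺++_)
open import Relation.Binary.Definitions using (tri<; tri≈; tri>)
open import Relation.Binary.PropositionalEquality
  using (_≡_; _≢_; refl; sym; trans; cong; subst; subst₂; module ≡-Reasoning)
open import Relation.Nullary using (¬_; yes; no)
open import Relation.Nullary.Decidable using (T?)
open import Defs

private variable
  k : ℕ
  A : Set
  G : A → A → Set
  u v w x y z : A
  xs ys : List A

-- Order and steps in duplicate-free lists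

data Before {A : Set} : List A → A → A → Set where
  at-head : y ∈ xs → Before (x ∷ xs) x y
  in-tail : Before xs x y → Before (z ∷ xs) x y

Before-∈ˡ : Before xs x y → x ∈ xs
Before-∈ˡ (at-head _) = here refl
Before-∈ˡ (in-tail b) = there (Before-∈ˡ b)

Before-∈ʳ : Before xs x y → y ∈ xs
Before-∈ʳ (at-head y∈) = there y∈
Before-∈ʳ (in-tail b) = there (Before-∈ʳ b)

Before-total : x ∈ xs → y ∈ xs → x ≢ y → Before xs x y ⊎ Before xs y x
Before-total (here refl) (here refl) x≢y = ⊥-elim (x≢y refl)
Before-total (here refl) (there y∈) _ = inj₁ (at-head y∈)
Before-total (there x∈) (here refl) _ = inj₂ (at-head x∈)
Before-total (there x∈) (there y∈) x≢y with Before-total x∈ y∈ x≢y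
... | inj₁ b = inj₁ (in-tail b)
... | inj₂ b = inj₂ (in-tail b)

steps-∈ˡ : (u , v) ∈ steps xs → u ∈ xs
steps-∈ˡ {xs = _ ∷ _ ∷ _} (here refl) = here refl
steps-∈ˡ {xs = _ ∷ _ ∷ _} (there p) = there (steps-∈ˡ p)

steps-∈ʳ-tail : (u , v) ∈ steps (x ∷ xs) → v ∈ xs
steps-∈ʳ-tail {xs = _ ∷ _} (here refl) = here refl
steps-∈ʳ-tail {xs = _ ∷ _} (there p) = there (steps-∈ʳ-tail p)

steps⇒Before : (u , v) ∈ steps xs → Before xs u v
steps⇒Before {xs = _ ∷ _ ∷ _} (here refl) = at-head (here refl)
steps⇒Before {xs = _ ∷ _ ∷ _} (there p) = in-tail (steps⇒Before p)

last-∈ : last xs ≡ just x → x ∈ xs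
last-∈ {xs = _ ∷ []} refl = here refl
last-∈ {xs = _ ∷ _ ∷ _} eq = there (last-∈ eq)

∃-step-into-tail : v ∈ xs → ∃[ u ] (u , v) ∈ steps (x ∷ xs)
∃-step-into-tail {x = x} (here refl) = x , here refl
∃-step-into-tail {xs = _ ∷ _ ∷ _} (there v∈) with ∃-step-into-tail v∈
... | u , p = u , there p

∃-step-into : head xs ≡ just x → v ∈ xs → v ≢ x → ∃[ u ] (u , v) ∈ steps xs
∃-step-into {xs = _ ∷ _} refl (here refl) v≢x = ⊥-elim (v≢x refl)
∃-step-into {xs = _ ∷ _} refl (there v∈) _ = ∃-step-into-tail v∈

∃-step-from : last xs ≡ just z → v ∈ xs → v ≢ z → ∃[ w ] (v , w) ∈ steps xs
∃-step-from {xs = _ ∷ []} refl (here refl) v≢z = ⊥-elim (v≢z refl)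
∃-step-from {xs = _ ∷ y ∷ _} _ (here refl) _ = y , here refl
∃-step-from {xs = _ ∷ _ ∷ _} eq (there v∈) v≢z with ∃-step-from eq v∈ v≢z
... | w , p = w , there p

∉-tail : Unique (x ∷ xs) → x ∉ xs
∉-tail (x≢xs ∷ _) = All¬⇒¬Any x≢xs

Before-irreflexive : Unique xs → ¬ Before xs x x
Before-irreflexive u (at-head x∈) = ∉-tail u x∈
Before-irreflexive (_ ∷ u) (in-tail b) = Before-irreflexive u b

¬Before-head : Unique (x ∷ xs) → ¬ Before (x ∷ xs) y x
¬Before-head u (at-head x∈) = ∉-tail u x∈
¬Before-head u (in-tail b) = ∉-tail u (Before-∈ʳ b)

¬Before-last : Unique xs → last xs ≡ just z → ¬ Before xs z y
¬Before-last {xs = _ ∷ _ ∷ _} u eq (at-head _) = ∉-tail u (last-∈ eq)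
¬Before-last {xs = _ ∷ _ ∷ _} (_ ∷ u) eq (in-tail b) = ¬Before-last u eq b

steps-irreflexive : ∀ {xs : List A} {u} → Unique xs → (u , u) ∉ steps xs
steps-irreflexive u p = Before-irreflexive u (steps⇒Before p)

no-step-into-head : Unique xs → head xs ≡ just x → (u , x) ∉ steps xs
no-step-into-head {xs = _ ∷ _} u refl st = ¬Before-head u (steps⇒Before st)

no-step-out-of-last : Unique xs → last xs ≡ just x → (x , v) ∉ steps xs
no-step-out-of-last u eq st = ¬Before-last u eq (steps⇒Before st)

steps-functional : Unique xs → (u , v) ∈ steps xs → (u , w) ∈ steps xs → v ≡ w
steps-functional {xs = _ ∷ _ ∷ _} _ (here refl) (here refl) = refl
steps-functional {xs = _ ∷ _ ∷ _} u (here refl) (there q) = ⊥-elim (∉-tail u (steps-∈ˡ q))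
steps-functional {xs = _ ∷ _ ∷ _} u (there p) (here refl) = ⊥-elim (∉-tail u (steps-∈ˡ p))
steps-functional {xs = _ ∷ _ ∷ _} (_ ∷ u) (there p) (there q) = steps-functional u p q

steps-injective : Unique xs → (u , w) ∈ steps xs → (v , w) ∈ steps xs → u ≡ v
steps-injective {xs = _ ∷ _ ∷ _} _ (here refl) (here refl) = refl
steps-injective {xs = _ ∷ _ ∷ _} (_ ∷ u) (here refl) (there q) = ⊥-elim (∉-tail u (steps-∈ʳ-tail q))
steps-injective {xs = _ ∷ _ ∷ _} (_ ∷ u) (there p) (here refl) = ⊥-elim (∉-tail u (steps-∈ʳ-tail p))
steps-injective {xs = _ ∷ _ ∷ _} (_ ∷ u) (there p) (there q) = steps-injective u p q

Before-step : Unique xs → (u , v) ∈ steps xs → Before xs u w → w ≢ v → Before xs v w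
Before-step {xs = _ ∷ _ ∷ _} _ (here refl) (at-head (here refl)) w≢v = ⊥-elim (w≢v refl)
Before-step {xs = _ ∷ _ ∷ _} _ (here refl) (at-head (there w∈)) _ = in-tail (at-head w∈)
Before-step {xs = _ ∷ _ ∷ _} u (here refl) (in-tail b) _ = ⊥-elim (∉-tail u (Before-∈ˡ b))
Before-step {xs = _ ∷ _ ∷ _} u (there p) (at-head _) _ = ⊥-elim (∉-tail u (steps-∈ˡ p))
Before-step {xs = _ ∷ _ ∷ _} (_ ∷ u) (there p) (in-tail b) w≢v = in-tail (Before-step u p b w≢v)

Unique-steps : Unique xs → Unique (steps xs)
Unique-steps {xs = []} _ = []
Unique-steps {xs = _ ∷ []} _ = []
Unique-steps {xs = _ ∷ _ ∷ _} u@(_ ∷ u′) =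
  All.tabulate (λ p eq → ∉-tail u (subst (λ e → proj₁ e ∈ _) (sym eq) (steps-∈ˡ p))) ∷ Unique-steps u′

head-steps : Unique xs → head xs ≡ just x → (x , y) ∈ steps xs → head (steps xs) ≡ just (x , y)
head-steps {xs = _ ∷ _ ∷ _} u refl p = cong (λ y → just (_ , y)) (steps-functional u (here refl) p)

last-steps : Unique xs → last xs ≡ just z → (y , z) ∈ steps xs → last (steps xs) ≡ just (y , z)
last-steps {xs = _ ∷ _ ∷ []} _ refl (here refl) = refl
last-steps {xs = _ ∷ _ ∷ _ ∷ _} (_ ∷ u) eq (here refl) = ⊥-elim (∉-tail u (last-∈ {xs = _ ∷ _} eq))
last-steps {xs = _ ∷ _ ∷ _ ∷ _} (_ ∷ u) eq (there p) = last-steps u eq p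

steps⇒Linked : All (λ e → G (proj₁ e) (proj₂ e)) (steps xs) → Linked G xs
steps⇒Linked {xs = []} _ = []
steps⇒Linked {xs = _ ∷ []} _ = [-]
steps⇒Linked {xs = _ ∷ _ ∷ _} (r ∷ rs) = r ∷ steps⇒Linked rs

Linked⇒steps : Linked G xs → All (λ e → G (proj₁ e) (proj₂ e)) (steps xs)
Linked⇒steps [] = []
Linked⇒steps [-] = []
Linked⇒steps (r ∷ rs) = r ∷ Linked⇒steps rs

Linked-step : Linked G xs → (u , v) ∈ steps xs → G u v
Linked-step l p = All.lookup (Linked⇒steps l) p

Before-AllPairs : AllPairs G xs → Before xs x y → G x y
Before-AllPairs (r ∷ _) (at-head y∈) = All.lookup r y∈
Before-AllPairs (_ ∷ rs) (in-tail b) = Before-AllPairs rs b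

Linked-Before : Linked G xs → Before xs x y → TransClosure G x y
Linked-Before l = Before-AllPairs (Linked⇒AllPairs _⁺++_ (Linked.map [_] l))

⁺-rank : (rk : A → ℕ) → (∀ {u v} → G u v → rk u < rk v) → TransClosure G u v → rk u < rk v
⁺-rank rk inc [ r ] = inc r
⁺-rank rk inc (r ∷ rs) = <-trans (inc r) (⁺-rank rk inc rs)

Linked-rank-Unique : (rk : A → ℕ) → Linked (λ u v → rk u < rk v) xs → Unique xs
Linked-rank-Unique rk l = AllPairs.map (λ lt eq → <-irrefl (cong rk eq) lt) (Linked⇒AllPairs <-trans l)

Unique-⊆⇒↭ : Unique ys → ys ⊆ xs → ∃[ zs ] xs ↭ ys ++ zs
Unique-⊆⇒↭ {ys = []} {xs = xs} _ _ = xs , ↭-refl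
Unique-⊆⇒↭ {ys = y ∷ ys} u@(_ ∷ u′) ys⊆xs with ∈-∃++ (ys⊆xs (here refl))
... | as , bs , refl with Unique-⊆⇒↭ u′ ys⊆as++bs
  where
  ys⊆as++bs : ys ⊆ as ++ bs
  ys⊆as++bs {z} z∈ with ∈-++⁻ as (ys⊆xs (there z∈))
  ... | inj₁ z∈as = ∈-++⁺ˡ z∈as
  ... | inj₂ (here refl) = ⊥-elim (∉-tail u z∈)
  ... | inj₂ (there z∈bs) = ∈-++⁺ʳ as z∈bs
... | zs , as++bs↭ = zs , ↭-trans (shift y as bs) (prep y as++bs↭)

sum-map-mono : (f : A → ℕ) → Unique ys → ys ⊆ xs → sum (map f ys) ≤ sum (map f xs)
sum-map-mono {ys = ys} {xs = xs} f u ys⊆xs with Unique-⊆⇒↭ u ys⊆xs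
... | zs , xs↭ = begin
  sum (map f ys)                   ≤⟨ m≤m+n _ _ ⟩
  sum (map f ys) + sum (map f zs)  ≡⟨ sum-++ (map f ys) (map f zs) ⟨
  sum (map f ys ++ map f zs)       ≡⟨ cong sum (map-++ f ys zs) ⟨
  sum (map f (ys ++ zs))           ≡⟨ sum-↭ (↭-map⁺ f xs↭) ⟨
  sum (map f xs)                   ∎
  where open ≤-Reasoning

length-mono : Unique ys → ys ⊆ xs → length ys ≤ length xs
length-mono {ys = ys} {xs = xs} u ys⊆xs with Unique-⊆⇒↭ u ys⊆xs
... | zs , xs↭ = begin
  length ys               ≤⟨ m≤m+n _ _ ⟩
  length ys + length zs   ≡⟨ length-++ ys ⟨
  length (ys ++ zs)       ≡⟨ ↭-length xs↭ ⟨
  length xs               ∎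
  where open ≤-Reasoning

length-filterᵇ-∷ : (p : A → Bool) → length (filterᵇ p xs) ≤ length (filterᵇ p (x ∷ xs))
length-filterᵇ-∷ {x = x} p with p x
... | true = n≤1+n _
... | false = ≤-refl

length-filterᵇ-≤-+ : (p q r : A → Bool) → (∀ {x} → x ∈ xs → p x ≡ q x ⊎ p x ≡ r x) →
  length (filterᵇ p xs) ≤ length (filterᵇ q xs) + length (filterᵇ r xs)
length-filterᵇ-≤-+ {xs = []} p q r _ = z≤n
length-filterᵇ-≤-+ {xs = x ∷ xs} p q r h
  with ih ← length-filterᵇ-≤-+ p q r (h ∘ there) | p x | h (here refl)
... | false | _ = ≤-trans ih (+-mono-≤ (length-filterᵇ-∷ q) (length-filterᵇ-∷ r))
... | true | inj₁ q≡ rewrite sym q≡ = s≤s (≤-trans ih (+-monoʳ-≤ _ (length-filterᵇ-∷ r)))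
... | true | inj₂ r≡ rewrite sym r≡ =
  ≤-trans (s≤s (≤-trans ih (+-mono-≤ (length-filterᵇ-∷ q) ≤-refl))) (≤-reflexive (sym (+-suc _ _)))

odd : ℕ → Bool
odd zero = false
odd (suc n) = not (odd n)

odd-2* : ∀ n → odd (2 * n) ≡ false
odd-2* zero = refl
odd-2* (suc n) rewrite +-suc n (n + 0) = trans (not-involutive _) (odd-2* n)

switches : (A → Bool) → List A → ℕ
switches g xs = length (filterᵇ (λ e → g (proj₁ e) xor g (proj₂ e)) (steps xs))

odd-switches : (g : A → Bool) → head xs ≡ just x → last xs ≡ just y → odd (switches g xs) ≡ g x xor g y
odd-switches {xs = x ∷ []} g refl refl = sym (xor-same (g x))
odd-switches {xs = x ∷ z ∷ zs} g refl eq
  with ih ← odd-switches {xs = z ∷ zs} g refl eq | g x | g z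
... | true  | true  = ih
... | false | false = ih
... | true  | false rewrite ih = refl
... | false | true  rewrite ih = not-involutive _

head-++ : head xs ≡ just x → head (xs ++ ys) ≡ just x
head-++ {xs = _ ∷ _} eq = eq

last-++ : last ys ≡ just y → last (xs ++ ys) ≡ just y
last-++ {xs = []} eq = eq
last-++ {ys = _ ∷ _} {xs = _ ∷ []} eq = eq
last-++ {ys = ys} {xs = _ ∷ x ∷ xs} eq = last-++ {ys = ys} {xs = x ∷ xs} eq

Linked-++ : Linked G xs → Linked G ys → last xs ≡ just u → head ys ≡ just v → G u v → Linked G (xs ++ ys)
Linked-++ {G = G} lx ly eqx eqy r = ++⁺ lx (subst₂ (Connected G) (sym eqx) (sym eqy) (just r)) ly

steps-++-join : last xs ≡ just u → head ys ≡ just v → (u , v) ∈ steps (xs ++ ys)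
steps-++-join {xs = _ ∷ []} {ys = _ ∷ _} refl refl = here refl
steps-++-join {xs = _ ∷ _ ∷ _} eqx eqy = there (steps-++-join {xs = _ ∷ _} eqx eqy)

steps-++⁺ʳ : ∀ {e : A × A} xs → e ∈ steps ys → e ∈ steps (xs ++ ys)
steps-++⁺ʳ [] p = p
steps-++⁺ʳ {ys = _ ∷ _} (_ ∷ []) p = there p
steps-++⁺ʳ (_ ∷ x ∷ xs) p = there (steps-++⁺ʳ (x ∷ xs) p)

-- Chains in acyclic relations

IsChain : (A → A → Set) → (Fin (suc k) → A) → Set
IsChain G F = ∀ e → G (F (inject₁ e)) (F (fsuc e))

chain-⁺ : {F : Fin (suc k) → A} → IsChain G F → ∀ {i j} → toℕ i < toℕ j → TransClosure G (F i) (F j)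
chain-⁺ {k = suc _} ch {fzero} {fsuc fzero} _ = [ ch fzero ]
chain-⁺ {k = suc _} {F = F} ch {fzero} {fsuc (fsuc j)} _ =
  ch fzero ∷ chain-⁺ {F = F ∘ fsuc} (ch ∘ fsuc) {fzero} {fsuc j} (s≤s z≤n)
chain-⁺ {k = suc _} {F = F} ch {fsuc i} {fsuc j} (s≤s i<j) = chain-⁺ {F = F ∘ fsuc} (ch ∘ fsuc) i<j

into-chain-⁺ : {F : Fin (suc k) → A} → G x (F fzero) → IsChain G F → ∀ i → TransClosure G x (F i)
into-chain-⁺ r ch fzero = [ r ]
into-chain-⁺ {F = F} r ch (fsuc i) = r ∷ chain-⁺ {F = F} ch {fzero} {fsuc i} (s≤s z≤n)

out-of-chain-⁺ : {F : Fin (suc k) → A} → IsChain G F → G (F (fromℕ k)) y → ∀ i → TransClosure G (F i) y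
out-of-chain-⁺ {k = zero} ch r fzero = [ r ]
out-of-chain-⁺ {k = suc _} {F = F} ch r fzero = ch fzero ∷ out-of-chain-⁺ {F = F ∘ fsuc} (ch ∘ fsuc) r fzero
out-of-chain-⁺ {k = suc _} {F = F} ch r (fsuc i) = out-of-chain-⁺ {F = F ∘ fsuc} (ch ∘ fsuc) r i

data MaxView : Fin (suc k) → Set where
  max    : MaxView (fromℕ k)
  inject : (a : Fin k) → MaxView (inject₁ a)

max-view : (i : Fin (suc k)) → MaxView i
max-view {zero} fzero = max
max-view {suc k} fzero = inject fzero
max-view {suc k} (fsuc i) with max-view i
... | max = max
... | inject a = inject (fsuc a)

module _ {A : Set} {G : A → A → Set} (acyclic : ∀ v → ¬ TransClosure G v v) where

  chain-increasing : {F : Fin (suc k) → A} → IsChain G F → ∀ {i j} → G (F i) (F j) → toℕ i < toℕ j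
  chain-increasing ch {i} {j} r with <-cmp (toℕ i) (toℕ j)
  ... | tri< i<j _ _ = i<j
  ... | tri≈ _ i≡j _ rewrite toℕ-injective i≡j = ⊥-elim (acyclic _ [ r ])
  ... | tri> _ _ j<i = ⊥-elim (acyclic _ (r ∷ chain-⁺ ch j<i))

  module _ (unique : Unique xs) (linked : Linked G xs) where

    no-shortcut : w ∈ xs → (u , v) ∈ steps xs → TransClosure G u w → TransClosure G w v → ⊥
    no-shortcut w∈ st u⇝w w⇝v with Before-total w∈ (steps-∈ˡ st) (λ { refl → acyclic _ u⇝w })
    ... | inj₁ w<u = acyclic _ (Linked-Before linked w<u ⁺++ u⇝w)
    ... | inj₂ u<w = acyclic _ (Linked-Before linked (Before-step unique st u<w (λ { refl → acyclic _ w⇝v })) ⁺++ w⇝v)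

    module _ {F : Fin (suc k) → A} (ch : IsChain G F) (F∈ : ∀ i → F i ∈ xs) where

      step-on-chain : ∀ {i j} → (F i , F j) ∈ steps xs → ∃[ a ] i ≡ inject₁ a × j ≡ fsuc a
      step-on-chain {i} {j} st with <-cmp (toℕ i) (toℕ j)
      ... | tri> _ _ j<i = ⊥-elim (acyclic _ (Linked-step linked st ∷ chain-⁺ ch j<i))
      ... | tri≈ _ i≡j _ rewrite toℕ-injective i≡j = ⊥-elim (steps-irreflexive unique st)
      ... | tri< i<j _ _ with max-view i
      ...   | max = ⊥-elim (<-irrefl refl (<-≤-trans (subst (_< toℕ j) (toℕ-fromℕ k) i<j) (toℕ≤pred[n] j)))
      ...   | inject a with j ≟ᶠ fsuc a
      ...     | yes refl = a , refl , refl
      ...     | no j≢ = ⊥-elim (no-shortcut (F∈ (fsuc a)) st [ ch a ] (chain-⁺ ch a+1<j))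
        where
        a+1<j : suc (toℕ a) < toℕ j
        a+1<j = ≤∧≢⇒< (subst (_< toℕ j) (toℕ-inject₁ a) i<j) (λ eq → j≢ (toℕ-injective (sym eq)))

      step-into-chain : G x (F fzero) → ∀ {i} → (x , F i) ∈ steps xs → i ≡ fzero
      step-into-chain r {fzero} st = refl
      step-into-chain r {fsuc i} st = ⊥-elim (no-shortcut (F∈ (inject₁ i)) st (into-chain-⁺ {F = F} r ch _) [ ch i ])

      step-out-of-chain : G (F (fromℕ k)) y → ∀ {i} → (F i , y) ∈ steps xs → i ≡ fromℕ k
      step-out-of-chain r {i} st with max-view i
      ... | max = refl
      ... | inject a = ⊥-elim (no-shortcut (F∈ (fsuc a)) st [ ch a ] (out-of-chain-⁺ {F = F} ch r _))

      step-over-chain : G x (F fzero) → G (F (fromℕ k)) y → (x , y) ∉ steps xs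
      step-over-chain r r′ st = no-shortcut (F∈ fzero) st [ r ] (out-of-chain-⁺ {F = F} ch r′ fzero)

prefix : (Fin (suc k) → A) → Fin (suc k) → List A
prefix F fzero = F fzero ∷ []
prefix {k = suc _} F (fsuc i) = F fzero ∷ prefix (F ∘ fsuc) i

suffix : (Fin (suc k) → A) → Fin (suc k) → List A
suffix {k = k} F fzero = prefix F (fromℕ k)
suffix {k = suc _} F (fsuc i) = suffix (F ∘ fsuc) i

prefix-head : (F : Fin (suc k) → A) → ∀ i → head (prefix F i) ≡ just (F fzero)
prefix-head F fzero = refl
prefix-head {k = suc _} F (fsuc _) = refl

prefix-last : (F : Fin (suc k) → A) → ∀ i → last (prefix F i) ≡ just (F i)
prefix-last F fzero = refl
prefix-last {k = suc _} F (fsuc i) = last-++ {ys = prefix (F ∘ fsuc) i} {xs = F fzero ∷ []} (prefix-last (F ∘ fsuc) i)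

suffix-head : (F : Fin (suc k) → A) → ∀ i → head (suffix F i) ≡ just (F i)
suffix-head {k = k} F fzero = prefix-head F (fromℕ k)
suffix-head {k = suc _} F (fsuc i) = suffix-head (F ∘ fsuc) i

suffix-last : (F : Fin (suc k) → A) → ∀ i → last (suffix F i) ≡ just (F (fromℕ k))
suffix-last {k = k} F fzero = prefix-last F (fromℕ k)
suffix-last {k = suc _} F (fsuc i) = suffix-last (F ∘ fsuc) i

prefix-Linked : {F : Fin (suc k) → A} → IsChain G F → ∀ i → Linked G (prefix F i)
prefix-Linked ch fzero = [-]
prefix-Linked {k = suc _} ch (fsuc fzero) = ch fzero ∷ [-]
prefix-Linked {k = suc (suc _)} {F = F} ch (fsuc (fsuc i)) = ch fzero ∷ prefix-Linked {F = F ∘ fsuc} (ch ∘ fsuc) (fsuc i)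

suffix-Linked : {F : Fin (suc k) → A} → IsChain G F → ∀ i → Linked G (suffix F i)
suffix-Linked {k = k} ch fzero = prefix-Linked ch (fromℕ k)
suffix-Linked {k = suc _} {F = F} ch (fsuc i) = suffix-Linked {F = F ∘ fsuc} (ch ∘ fsuc) i

∈-prefix : (F : Fin (suc k) → A) → ∀ {i j} → toℕ j ≤ toℕ i → F j ∈ prefix F i
∈-prefix F {fzero} {fzero} _ = here refl
∈-prefix {k = suc _} F {fsuc _} {fzero} _ = here refl
∈-prefix {k = suc _} F {fsuc i} {fsuc j} (s≤s j≤i) = there (∈-prefix (F ∘ fsuc) j≤i)

∈-suffix : (F : Fin (suc k) → A) → ∀ {i j} → toℕ i ≤ toℕ j → F j ∈ suffix F i
∈-suffix {k = k} F {fzero} {j} _ = ∈-prefix F (subst (toℕ j ≤_) (sym (toℕ-fromℕ k)) (toℕ≤pred[n] j))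
∈-suffix {k = suc _} F {fsuc i} {fsuc j} (s≤s i≤j) = ∈-suffix (F ∘ fsuc) i≤j

-- Crossings of chords

Outside : ℕ → ℕ → ℕ → Set
Outside z p q = (z < p × z < q) ⊎ (p < z × q < z)

private
  false-if : ∀ {b} → (T b → ⊥) → b ≡ false
  false-if {false} _ = refl
  false-if {true} ¬b = ⊥-elim (¬b _)

  true-if : ∀ {b} → T b → b ≡ true
  true-if = Equivalence.to T-≡

  <-comparisons : ∀ {z p} → z < p → (z ≡ᵇ p) ≡ false × (z <ᵇ p) ≡ true × (p <ᵇ z) ≡ false
  <-comparisons {z} {p} z<p =
    false-if (λ eq → <-irrefl (≡ᵇ⇒≡ z p eq) z<p) , true-if (<⇒<ᵇ z<p) , false-if (<-asym z<p ∘ <ᵇ⇒< p z)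

  >-comparisons : ∀ {z p} → p < z → (z ≡ᵇ p) ≡ false × (z <ᵇ p) ≡ false × (p <ᵇ z) ≡ true
  >-comparisons {z} {p} p<z =
    false-if (λ eq → <-irrefl (sym (≡ᵇ⇒≡ z p eq)) p<z) , false-if (<-asym p<z ∘ <ᵇ⇒< z p) , true-if (<⇒<ᵇ p<z)

  same-comparisons : ∀ {z p q} → Outside z p q →
    (z ≡ᵇ p) ≡ (z ≡ᵇ q) × (z <ᵇ p) ≡ (z <ᵇ q) × (p <ᵇ z) ≡ (q <ᵇ z)
  same-comparisons (inj₁ (z<p , z<q)) with <-comparisons z<p | <-comparisons z<q
  ... | e₁ , l₁ , g₁ | e₂ , l₂ , g₂ = trans e₁ (sym e₂) , trans l₁ (sym l₂) , trans g₁ (sym g₂)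
  same-comparisons (inj₂ (p<z , q<z)) with >-comparisons p<z | >-comparisons q<z
  ... | e₁ , l₁ , g₁ | e₂ , l₂ , g₂ = trans e₁ (sym e₂) , trans l₁ (sym l₂) , trans g₁ (sym g₂)

module _ {m n : ℕ} where

  -- No endpoint of the chord lies between p and q, so p and q are on the same side of it.
  Unseparated : Edge m n → Vtx m n → Vtx m n → Set
  Unseparated (c , d) p q = Outside (pos c) (pos p) (pos q) × Outside (pos d) (pos p) (pos q)

  crossᵇ-congˡ : ∀ {p q x} f → Unseparated f p q → crossᵇ (p , x) f ≡ crossᵇ (q , x) f
  crossᵇ-congˡ (c , d) (oc , od) with same-comparisons oc | same-comparisons od
  ... | e₁ , l₁ , g₁ | e₂ , l₂ , g₂ rewrite e₁ | l₁ | g₁ | e₂ | l₂ | g₂ = refl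

  crossᵇ-congʳ : ∀ {p q x} f → Unseparated f p q → crossᵇ (x , p) f ≡ crossᵇ (x , q) f
  crossᵇ-congʳ (c , d) (oc , od) with same-comparisons oc | same-comparisons od
  ... | e₁ , l₁ , g₁ | e₂ , l₂ , g₂ rewrite e₁ | l₁ | g₁ | e₂ | l₂ | g₂ = refl

  edgeCrossings-triangle : ∀ {E : List (Edge m n)} {w w′ v v′} →
    (∀ {f} → f ∈ E → Unseparated f w w′ ⊎ Unseparated f v v′) →
    edgeCrossings E (w , v) ≤ edgeCrossings E (w′ , v) + edgeCrossings E (w , v′)
  edgeCrossings-triangle {w = w} {w′} {v} {v′} h =
    length-filterᵇ-≤-+ (crossᵇ (w , v)) (crossᵇ (w′ , v)) (crossᵇ (w , v′)) λ {f} f∈ →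
      Sum.map (crossᵇ-congˡ {w} {w′} {v} f) (crossᵇ-congʳ {v} {v′} {w} f) (h f∈)

-- The two sides of an st-polygon

data Side : Set where
  left right : Side

opposite : Side → Side
opposite left = right
opposite right = left

side-cases : ∀ σ τ → τ ≡ σ ⊎ τ ≡ opposite σ
side-cases left left = inj₁ refl
side-cases left right = inj₂ refl
side-cases right left = inj₂ refl
side-cases right right = inj₁ refl

isRight : Side → Bool
isRight left = false
isRight right = true

isRight-injective : ∀ σ τ → isRight σ xor isRight τ ≡ false → σ ≡ τ
isRight-injective left left _ = refl
isRight-injective right right _ = refl

module _ {m n : ℕ} where

  size : Side → ℕ
  size left = m
  size right = n

  side : (σ : Side) → Fin (suc (size σ)) → Vtx m n
  side left = L
  side right = R

  end : (σ : Side) → Fin (suc (size σ))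
  end σ = fromℕ (size σ)

  data SideView (σ : Side) : Vtx m n → Set where
    source : SideView σ s
    sink   : SideView σ t
    own    : ∀ i → SideView σ (side σ i)
    other  : ∀ j → SideView σ (side (opposite σ) j)

  side-view : ∀ σ v → SideView σ v
  side-view σ s = source
  side-view σ t = sink
  side-view left (L i) = own i
  side-view left (R j) = other j
  side-view right (L i) = other i
  side-view right (R j) = own j

  side≢s : ∀ σ {i} → side σ i ≢ s
  side≢s left ()
  side≢s right ()

  side≢t : ∀ σ {i} → side σ i ≢ t
  side≢t left ()
  side≢t right ()

  side≢opposite : ∀ σ {i j} → side σ i ≢ side (opposite σ) j
  side≢opposite left ()
  side≢opposite right ()

  side-injective : ∀ σ {i j} → side σ i ≡ side σ j → i ≡ j
  side-injective left refl = refl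
  side-injective right refl = refl

module Embedding (m n : ℕ) where

  pos-L : ∀ i → 0 < pos {m} {n} (L i) × pos {m} {n} (L i) < 2 + m
  pos-L i = s≤s z≤n , s≤s (toℕ<n i)

  pos-R : ∀ j → 2 + m < pos {m} {n} (R j)
  pos-R j = subst (_< pos {m} {n} (R j)) (+-identityʳ (2 + m)) (+-monoʳ-< (2 + m) (m<n⇒0<n∸m (toℕ<n j)))

  keeps-right-side : ∀ (u w : Vtx m n) → pos u ≤ 2 + m → pos w ≤ 2 + m →
                     ∃[ σ ] ∀ i i′ → Unseparated (u , w) (side σ i) (side σ i′)
  keeps-right-side _ _ u≤ w≤ = right , λ j j′ → outside u≤ j j′ , outside w≤ j j′
    where
    outside : ∀ {z} → z ≤ 2 + m → ∀ j j′ → Outside z (pos {m} {n} (R j)) (pos {m} {n} (R j′))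
    outside z≤ j j′ = inj₁ (≤-<-trans z≤ (pos-R j) , ≤-<-trans z≤ (pos-R j′))

  keeps-left-side : ∀ (u w : Vtx m n) → pos u ≡ 0 ⊎ 2 + m ≤ pos u → pos w ≡ 0 ⊎ 2 + m ≤ pos w →
                    ∃[ σ ] ∀ i i′ → Unseparated (u , w) (side σ i) (side σ i′)
  keeps-left-side _ _ u≥ w≥ = left , λ i i′ → outside u≥ i i′ , outside w≥ i i′
    where
    outside : ∀ {z} → z ≡ 0 ⊎ 2 + m ≤ z → ∀ i i′ → Outside z (pos {m} {n} (L i)) (pos {m} {n} (L i′))
    outside (inj₁ refl) i i′ = inj₁ (proj₁ (pos-L i) , proj₁ (pos-L i′))
    outside (inj₂ z≥) i i′ = inj₂ (<-≤-trans (proj₂ (pos-L i)) z≥ , <-≤-trans (proj₂ (pos-L i′)) z≥)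

-- Positions in the tour s, V₀ … Vₐ, W₀ … W_kW, Vₐ₊₁ … V_kV, t
module TourRank (kV kW : ℕ) (a : Fin kV) where

  along : Fin (suc kV) → ℕ
  along i with toℕ i ≤? toℕ a
  ... | yes _ = suc (toℕ i)
  ... | no _ = toℕ i + suc (suc kW)

  across : Fin (suc kW) → ℕ
  across j = suc (suc (toℕ a + toℕ j))

  top : ℕ
  top = 3 + kV + kW

  along-mono : ∀ {i j} → toℕ i < toℕ j → along i < along j
  along-mono {i} {j} i<j with toℕ i ≤? toℕ a | toℕ j ≤? toℕ a
  ... | yes _ | yes _ = s≤s i<j
  ... | yes _ | no _ = ≤-trans (s≤s i<j) (m<m+n (toℕ j) z<s)
  ... | no i≰a | yes j≤a = ⊥-elim (i≰a (≤-trans (<⇒≤ i<j) j≤a))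
  ... | no _ | no _ = +-monoˡ-< (suc (suc kW)) i<j

  along-positive : ∀ i → 0 < along i
  along-positive i with toℕ i ≤? toℕ a
  ... | yes _ = s≤s z≤n
  ... | no _ = <-≤-trans z<s (m≤n+m (suc (suc kW)) (toℕ i))

  along<top : ∀ i → along i < top
  along<top i with toℕ i ≤? toℕ a
  ... | yes _ = s≤s (s≤s (≤-trans (toℕ≤pred[n] i) (≤-trans (m≤m+n kV kW) (n≤1+n _))))
  ... | no _ = s≤s (begin
    toℕ i + suc (suc kW)  ≤⟨ +-monoˡ-≤ (suc (suc kW)) (toℕ≤pred[n] i) ⟩
    kV + suc (suc kW)     ≡⟨ +-suc kV (suc kW) ⟩
    suc (kV + suc kW)     ≡⟨ cong suc (+-suc kV kW) ⟩
    suc (suc (kV + kW))   ∎)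
    where open ≤-Reasoning

  across-mono : ∀ {i j} → toℕ i < toℕ j → across i < across j
  across-mono i<j = s≤s (s≤s (+-monoʳ-< (toℕ a) i<j))

  across<top : ∀ j → across j < top
  across<top j = s≤s (s≤s (s≤s (+-mono-≤ (<⇒≤ (toℕ<n a)) (toℕ≤pred[n] j))))

  along-inject₁<across-zero : along (inject₁ a) < across fzero
  along-inject₁<across-zero with toℕ (inject₁ a) ≤? toℕ a
  ... | yes _ = s≤s (s≤s (≤-reflexive (trans (toℕ-inject₁ a) (sym (+-identityʳ (toℕ a))))))
  ... | no a≰a = ⊥-elim (a≰a (≤-reflexive (toℕ-inject₁ a)))

  across-max<along-suc : across (fromℕ kW) < along (fsuc a)
  across-max<along-suc with suc (toℕ a) ≤? toℕ a
  ... | yes a<a = ⊥-elim (<-irrefl refl a<a)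
  ... | no _ = s≤s (≤-reflexive (begin
    suc (suc (toℕ a + toℕ (fromℕ kW)))  ≡⟨ cong (λ x → suc (suc (toℕ a + x))) (toℕ-fromℕ kW) ⟩
    suc (suc (toℕ a + kW))              ≡⟨ cong suc (+-suc (toℕ a) kW) ⟨
    suc (toℕ a + suc kW)                ≡⟨ +-suc (toℕ a) (suc kW) ⟨
    toℕ a + suc (suc kW)                ∎))
    where open ≡-Reasoning

module _ {m n : ℕ} where

  -- With s put on the side σ of the first step and t on the side τ of the last one, the steps
  -- that switch sides are exactly the edges of P.
  onRight : Side → Side → Vtx m n → Bool
  onRight σ τ s = isRight σ
  onRight σ τ t = isRight τ
  onRight σ τ (L _) = false
  onRight σ τ (R _) = true

  onRight-side : ∀ σ τ ρ {i} → onRight σ τ (side ρ i) ≡ isRight ρ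
  onRight-side σ τ left = refl
  onRight-side σ τ right = refl

  tourRank : (σ : Side) → Fin (size {m} {n} σ) → Vtx m n → ℕ
  tourRank σ a s = 0
  tourRank σ a t = 3 + size {m} {n} σ + size {m} {n} (opposite σ)
  tourRank left a (L i) = TourRank.along m n a i
  tourRank left a (R j) = TourRank.across m n a j
  tourRank right a (L i) = TourRank.across n m a i
  tourRank right a (R j) = TourRank.along n m a j

  tourRank-positive : ∀ σ a τ i → tourRank σ a s < tourRank σ a (side τ i)
  tourRank-positive left a left i = TourRank.along-positive m n a i
  tourRank-positive left a right i = z<s
  tourRank-positive right a left i = z<s
  tourRank-positive right a right i = TourRank.along-positive n m a i

  tourRank<top : ∀ σ a τ i → tourRank σ a (side τ i) < tourRank σ a t
  tourRank<top left a left = TourRank.along<top m n a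
  tourRank<top left a right = TourRank.across<top m n a
  tourRank<top right a left = TourRank.across<top n m a
  tourRank<top right a right = TourRank.along<top n m a

  tourRank-mono : ∀ σ a τ {i j} → toℕ i < toℕ j → tourRank σ a (side τ i) < tourRank σ a (side τ j)
  tourRank-mono left a left = TourRank.along-mono m n a
  tourRank-mono left a right = TourRank.across-mono m n a
  tourRank-mono right a left = TourRank.across-mono n m a
  tourRank-mono right a right = TourRank.along-mono n m a

  tourRank-entry : ∀ σ a → tourRank σ a (side σ (inject₁ a)) < tourRank σ a (side (opposite σ) fzero)
  tourRank-entry left a = TourRank.along-inject₁<across-zero m n a
  tourRank-entry right a = TourRank.along-inject₁<across-zero n m a

  tourRank-exit : ∀ σ a → tourRank σ a (side (opposite σ) (end (opposite σ))) < tourRank σ a (side σ (fsuc a))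
  tourRank-exit left a = TourRank.across-max<along-suc m n a
  tourRank-exit right a = TourRank.across-max<along-suc n m a

  SameEndSteps : List (Edge m n) → List (Edge m n) → List (Edge m n) → Set
  SameEndSteps E P P′ = ∀ π π′ → InducedHP E P π → InducedHP E P′ π′ →
                          head (steps π) ≡ head (steps π′) × last (steps π) ≡ last (steps π′)

-- The st-polygon R = (V, E)

module Polygon {m n : ℕ} {E : List (Edge m n)} (poly : IsStPolygon m n E) where

  open Embedding m n

  E-acyclic : Acyclic E
  E-acyclic = let _ , (acyclic , _) , _ = poly in acyclic

  no-edge-into-s : ∀ u → (u , s) ∉ E
  no-edge-into-s = let _ , (_ , into-s , _) , _ = poly in into-s

  no-edge-out-of-t : ∀ v → (t , v) ∉ E
  no-edge-out-of-t = let _ , (_ , _ , _ , out-of-t , _) , _ = poly in out-of-t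

  s→side : ∀ σ → (s , side σ fzero) ∈ E
  s→side left = let _ , _ , sL , _ = poly in sL
  s→side right = let _ , _ , _ , _ , _ , sR , _ = poly in sR

  side-chain : ∀ σ → IsChain (Adj E) (side σ)
  side-chain left = let _ , _ , _ , chL , _ = poly in chL
  side-chain right = let _ , _ , _ , _ , _ , _ , chR , _ = poly in chR

  side→t : ∀ σ → (side σ (end σ) , t) ∈ E
  side→t left = let _ , _ , _ , _ , Lt , _ = poly in Lt
  side→t right = let _ , _ , _ , _ , _ , _ , _ , Rt , _ = poly in Rt

  private
    no-L-R : ∀ i j → (L i , R j) ∉ E × (R j , L i) ∉ E
    no-L-R = let _ , _ , _ , _ , _ , _ , _ , _ , noLR , _ = poly in noLR

  no-edge-across : ∀ σ i j → (side σ i , side (opposite σ) j) ∉ E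
  no-edge-across left i j = proj₁ (no-L-R i j)
  no-edge-across right j i = proj₂ (no-L-R i j)

  no-edge-back : ∀ σ i j → (side (opposite σ) j , side σ i) ∉ E
  no-edge-back left i j = proj₂ (no-L-R i j)
  no-edge-back right j i = proj₁ (no-L-R i j)

  edge-keeps-side : ∀ {u w} → (u , w) ∈ E → ∃[ σ ] ∀ i i′ → Unseparated (u , w) (side σ i) (side σ i′)
  edge-keeps-side {u} {s} e = ⊥-elim (no-edge-into-s u e)
  edge-keeps-side {t} {w} e = ⊥-elim (no-edge-out-of-t w e)
  edge-keeps-side {L i} {R j} e = ⊥-elim (no-edge-across left i j e)
  edge-keeps-side {R j} {L i} e = ⊥-elim (no-edge-back left i j e)
  edge-keeps-side {s} {t} _ = keeps-right-side s t z≤n ≤-refl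
  edge-keeps-side {s} {L i} _ = keeps-right-side s (L i) z≤n (<⇒≤ (proj₂ (pos-L i)))
  edge-keeps-side {s} {R j} _ = keeps-left-side s (R j) (inj₁ refl) (inj₂ (<⇒≤ (pos-R j)))
  edge-keeps-side {L i} {t} _ = keeps-right-side (L i) t (<⇒≤ (proj₂ (pos-L i))) ≤-refl
  edge-keeps-side {L i} {L i′} _ = keeps-right-side (L i) (L i′) (<⇒≤ (proj₂ (pos-L i))) (<⇒≤ (proj₂ (pos-L i′)))
  edge-keeps-side {R j} {t} _ = keeps-left-side (R j) t (inj₂ (<⇒≤ (pos-R j))) (inj₂ ≤-refl)
  edge-keeps-side {R j} {R j′} _ = keeps-left-side (R j) (R j′) (inj₂ (<⇒≤ (pos-R j))) (inj₂ (<⇒≤ (pos-R j′)))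

  E-rank-increasing : (r : Vtx m n → ℕ) → (∀ τ i → r s < r (side τ i)) → (∀ τ i → r (side τ i) < r t) → r s < r t →
                 (∀ τ {i j} → toℕ i < toℕ j → r (side τ i) < r (side τ j)) →
                 ∀ {u v} → (u , v) ∈ E → r u < r v
  E-rank-increasing r _ _ _ _ {u} {s} e = ⊥-elim (no-edge-into-s u e)
  E-rank-increasing r _ _ _ _ {t} {v} e = ⊥-elim (no-edge-out-of-t v e)
  E-rank-increasing r _ _ _ _ {L i} {R j} e = ⊥-elim (no-edge-across left i j e)
  E-rank-increasing r _ _ _ _ {R j} {L i} e = ⊥-elim (no-edge-back left i j e)
  E-rank-increasing r _ _ s<t _ {s} {t} _ = s<t
  E-rank-increasing r s< _ _ _ {s} {L i} _ = s< left i
  E-rank-increasing r s< _ _ _ {s} {R j} _ = s< right j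
  E-rank-increasing r _ <t _ _ {L i} {t} _ = <t left i
  E-rank-increasing r _ <t _ _ {R j} {t} _ = <t right j
  E-rank-increasing r _ _ _ mono {L i} {L j} e = mono left (chain-increasing E-acyclic (side-chain left) e)
  E-rank-increasing r _ _ _ mono {R i} {R j} e = mono right (chain-increasing E-acyclic (side-chain right) e)

  module Path {P : List (Edge m n)} (acyclic : Acyclic (E ++ P)) {π : List (Vtx m n)} (hp : InducedHP E P π) where

    π-unique : Unique π
    π-unique = proj₁ hp

    π-covers : ∀ v → v ∈ π
    π-covers = let _ , covers , _ = hp in covers

    π-head : head π ≡ just s
    π-head = let _ , _ , hd , _ = hp in hd

    π-last : last π ≡ just t
    π-last = let _ , _ , _ , lst , _ = hp in lst

    π-linked : Linked (Adj (E ++ P)) π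
    π-linked = let _ , _ , _ , _ , st , _ = hp in steps⇒Linked st

    P⊆steps : ∀ {e} → e ∈ P → e ∈ steps π
    P⊆steps = let _ , _ , _ , _ , _ , P-steps = hp in All.lookup P-steps

    step∉E⇒∈P : ∀ {u v} → (u , v) ∈ steps π → (u , v) ∉ E → (u , v) ∈ P
    step∉E⇒∈P st ∉E with ∈-++⁻ E (Linked-step π-linked st)
    ... | inj₁ ∈E = ⊥-elim (∉E ∈E)
    ... | inj₂ ∈P = ∈P

    no-step-into-s : ∀ {u} → (u , s) ∉ steps π
    no-step-into-s = no-step-into-head π-unique π-head

    no-step-out-of-t : ∀ {v} → (t , v) ∉ steps π
    no-step-out-of-t = no-step-out-of-last π-unique π-last

    private
      side-chain⁺ : ∀ σ → IsChain (Adj (E ++ P)) (side σ)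
      side-chain⁺ σ e = ∈-++⁺ˡ (side-chain σ e)

    step-on-side : ∀ σ {i j} → (side σ i , side σ j) ∈ steps π → ∃[ a ] i ≡ inject₁ a × j ≡ fsuc a
    step-on-side σ = step-on-chain acyclic π-unique π-linked (side-chain⁺ σ) (π-covers ∘ side σ)

    step-on-side∈E : ∀ σ {i j} → (side σ i , side σ j) ∈ steps π → (side σ i , side σ j) ∈ E
    step-on-side∈E σ st with step-on-side σ st
    ... | a , refl , refl = side-chain σ a

    step-into-side : ∀ σ {i} → (s , side σ i) ∈ steps π → i ≡ fzero
    step-into-side σ =
      step-into-chain acyclic π-unique π-linked (side-chain⁺ σ) (π-covers ∘ side σ) (∈-++⁺ˡ (s→side σ))

    step-out-of-side : ∀ σ {i} → (side σ i , t) ∈ steps π → i ≡ end σ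
    step-out-of-side σ =
      step-out-of-chain acyclic π-unique π-linked (side-chain⁺ σ) (π-covers ∘ side σ) (∈-++⁺ˡ (side→t σ))

    no-step-s-t : (s , t) ∉ steps π
    no-step-s-t = step-over-chain acyclic π-unique π-linked (side-chain⁺ left) (π-covers ∘ side left)
                    (∈-++⁺ˡ (s→side left)) (∈-++⁺ˡ (side→t left))

    first-step : ∃[ σ ] (s , side σ fzero) ∈ steps π
    first-step with ∃-step-from π-last (π-covers s) (λ ())
    ... | s , st = ⊥-elim (steps-irreflexive π-unique st)
    ... | t , st = ⊥-elim (no-step-s-t st)
    ... | L i , st with refl ← step-into-side left st = left , st
    ... | R j , st with refl ← step-into-side right st = right , st

    last-step : ∃[ σ ] (side σ (end σ) , t) ∈ steps π
    last-step with ∃-step-into π-head (π-covers t) (λ ())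
    ... | s , st = ⊥-elim (no-step-s-t st)
    ... | t , st = ⊥-elim (steps-irreflexive π-unique st)
    ... | L i , st with refl ← step-out-of-side left st = left , st
    ... | R j , st with refl ← step-out-of-side right st = right , st

    first-step-forced : ∀ σ {i} → (side σ i , side (opposite σ) fzero) ∈ P → (s , side σ fzero) ∈ steps π
    first-step-forced σ e with first-step
    ... | τ , st with side-cases σ τ
    ...   | inj₁ refl = st
    ...   | inj₂ refl = ⊥-elim (side≢s σ (sym (steps-injective π-unique st (P⊆steps e))))

    last-step-forced : ∀ σ {c} → (side (opposite σ) (end (opposite σ)) , side σ c) ∈ P →
                       (side σ (end σ) , t) ∈ steps π
    last-step-forced σ e with last-step
    ... | τ , st with side-cases σ τ
    ...   | inj₁ refl = st
    ...   | inj₂ refl = ⊥-elim (side≢t σ (sym (steps-functional π-unique st (P⊆steps e))))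

    module EndsOn (σ : Side) (first : (s , side σ fzero) ∈ steps π) (final : (side σ (end σ) , t) ∈ steps π) where

      V : Fin (suc (size {m} {n} σ)) → Vtx m n
      V = side σ

      W : Fin (suc (size {m} {n} (opposite σ))) → Vtx m n
      W = side (opposite σ)

      entry-edge : ∃[ a ] (V (inject₁ a) , W fzero) ∈ P
      entry-edge with ∃-step-into π-head (π-covers (W fzero)) (side≢s (opposite σ))
      ... | u , st with side-view σ u
      ...   | source = ⊥-elim (side≢opposite σ (steps-functional π-unique first st))
      ...   | sink = ⊥-elim (no-step-out-of-t st)
      ...   | other j with () ← proj₂ (proj₂ (step-on-side (opposite σ) st))
      ...   | own i with max-view i
      ...     | max = ⊥-elim (side≢t (opposite σ) (sym (steps-functional π-unique final st)))
      ...     | inject a = a , step∉E⇒∈P st (no-edge-across σ _ _)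

      return-edge : ∀ a → (V (inject₁ a) , W fzero) ∈ P → ∃[ b ] (W b , V (fsuc a)) ∈ P
      return-edge a entry with ∃-step-into π-head (π-covers (V (fsuc a))) (side≢s σ)
      ... | u , st with side-view σ u
      ...   | source with () ← step-into-side σ st
      ...   | sink = ⊥-elim (no-step-out-of-t st)
      ...   | other b = b , step∉E⇒∈P st (no-edge-back σ _ _)
      ...   | own i with step-on-side σ st
      ...     | _ , refl , refl =
                ⊥-elim (side≢opposite σ (steps-functional π-unique st (P⊆steps entry)))

      exit-edge : ∃[ c ] (W (end (opposite σ)) , V c) ∈ P
      exit-edge with ∃-step-from π-last (π-covers (W (end (opposite σ)))) (side≢t (opposite σ))
      ... | w , st with side-view σ w
      ...   | source = ⊥-elim (no-step-into-s st)
      ...   | sink = ⊥-elim (side≢opposite σ (sym (steps-injective π-unique st final)))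
      ...   | own c = c , step∉E⇒∈P st (no-edge-back σ _ _)
      ...   | other j with step-on-side (opposite σ) st
      ...     | _ , eq , _ = ⊥-elim (fromℕ≢inject₁ eq)

    module _ (P-unique : Unique P) (P∉E : All (_∉ E) P) {σ τ : Side}
             (first : (s , side σ fzero) ∈ steps π) (final : (side τ (end τ) , t) ∈ steps π) where

      private
        switch : Edge m n → Bool
        switch e = onRight σ τ (proj₁ e) xor onRight σ τ (proj₂ e)

      step-switches : ∀ {u v} → (u , v) ∈ steps π →
                      (switch (u , v) ≡ false × (u , v) ∈ E) ⊎ (switch (u , v) ≡ true × (u , v) ∉ E)
      step-switches {s} {v} st with refl ← steps-functional π-unique first st =
        inj₁ (trans (cong (isRight σ xor_) (onRight-side σ τ σ)) (xor-same (isRight σ)) , s→side σ)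
      step-switches {u} {t} st with refl ← steps-injective π-unique st final =
        inj₁ (trans (cong (_xor isRight τ) (onRight-side σ τ τ)) (xor-same (isRight τ)) , side→t τ)
      step-switches {t} {v} st = ⊥-elim (no-step-out-of-t st)
      step-switches {u} {s} st = ⊥-elim (no-step-into-s st)
      step-switches {L i} {L j} st = inj₁ (refl , step-on-side∈E left st)
      step-switches {R i} {R j} st = inj₁ (refl , step-on-side∈E right st)
      step-switches {L i} {R j} st = inj₂ (refl , no-edge-across left i j)
      step-switches {R j} {L i} st = inj₂ (refl , no-edge-back left i j)

      length-P≡switches : length P ≡ switches (onRight σ τ) π
      length-P≡switches =
        ≤-antisym (length-mono P-unique P⊆switching)
                  (length-mono (filter⁺ (T? ∘ switch) (Unique-steps π-unique)) switching⊆P)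
        where
        P⊆switching : P ⊆ filterᵇ switch (steps π)
        P⊆switching {u , v} e∈P with step-switches (P⊆steps e∈P)
        ... | inj₁ (_ , ∈E) = ⊥-elim (All.lookup P∉E e∈P ∈E)
        ... | inj₂ (sw , _) = ∈-filter⁺ (T? ∘ switch) (P⊆steps e∈P) (Equivalence.from T-≡ sw)

        switching⊆P : filterᵇ switch (steps π) ⊆ P
        switching⊆P {u , v} e∈ with ∈-filter⁻ (T? ∘ switch) e∈
        ... | st , T-sw with step-switches st
        ...   | inj₁ (sw , _) = ⊥-elim (subst T sw T-sw)
        ...   | inj₂ (_ , ∉E) = step∉E⇒∈P st ∉E

      odd-length-P : odd (length P) ≡ isRight σ xor isRight τ
      odd-length-P = trans (cong odd length-P≡switches) (odd-switches (onRight σ τ) π-head π-last)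

  module TwoEdges (σ : Side) (a : Fin (size {m} {n} σ)) where

    V : Fin (suc (size {m} {n} σ)) → Vtx m n
    V = side σ

    W : Fin (suc (size {m} {n} (opposite σ))) → Vtx m n
    W = side (opposite σ)

    P′ : List (Edge m n)
    P′ = (V (inject₁ a) , W fzero) ∷ (W (end (opposite σ)) , V (fsuc a)) ∷ []

    Vs₁ Ws Vs₂ : List (Vtx m n)
    Vs₁ = prefix V (inject₁ a)
    Ws = prefix W (end (opposite σ))
    Vs₂ = suffix V (fsuc a)

    tour : List (Vtx m n)
    tour = s ∷ Vs₁ ++ Ws ++ Vs₂ ++ t ∷ []

    rank-increasing : ∀ {u v} → (u , v) ∈ E ++ P′ → tourRank σ a u < tourRank σ a v
    rank-increasing e with ∈-++⁻ E e
    ... | inj₁ ∈E =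
      E-rank-increasing (tourRank σ a) (tourRank-positive σ a) (tourRank<top σ a) z<s (tourRank-mono σ a) ∈E
    ... | inj₂ (here refl) = tourRank-entry σ a
    ... | inj₂ (there (here refl)) = tourRank-exit σ a

    private
      E⁺ : ∀ {e} → e ∈ E → e ∈ E ++ P′
      E⁺ = ∈-++⁺ˡ

      chain⁺ : ∀ τ → IsChain (Adj (E ++ P′)) (side τ)
      chain⁺ τ = E⁺ ∘ side-chain τ

    tour-linked : Linked (Adj (E ++ P′)) tour
    tour-linked = Linked-++ {xs = s ∷ []} [-] from-Vs₁ refl (head-++ {xs = Vs₁} (prefix-head V _)) (E⁺ (s→side σ))
      where
      from-Vs₂ : Linked (Adj (E ++ P′)) (Vs₂ ++ t ∷ [])
      from-Vs₂ = Linked-++ {xs = Vs₂} (suffix-Linked (chain⁺ σ) (fsuc a)) [-]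
                   (suffix-last V (fsuc a)) refl (E⁺ (side→t σ))

      from-Ws : Linked (Adj (E ++ P′)) (Ws ++ Vs₂ ++ t ∷ [])
      from-Ws = Linked-++ {xs = Ws} (prefix-Linked (chain⁺ (opposite σ)) _) from-Vs₂
                  (prefix-last W _) (head-++ {xs = Vs₂} (suffix-head V (fsuc a))) (∈-++⁺ʳ E (there (here refl)))

      from-Vs₁ : Linked (Adj (E ++ P′)) (Vs₁ ++ Ws ++ Vs₂ ++ t ∷ [])
      from-Vs₁ = Linked-++ {xs = Vs₁} (prefix-Linked (chain⁺ σ) _) from-Ws
                   (prefix-last V _) (head-++ {xs = Ws} (prefix-head W _)) (∈-++⁺ʳ E (here refl))

    tour-covers : ∀ v → v ∈ tour
    tour-covers v with side-view σ v
    ... | source = here refl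
    ... | sink = there (∈-++⁺ʳ Vs₁ (∈-++⁺ʳ Ws (∈-++⁺ʳ Vs₂ (here refl))))
    ... | other j = there (∈-++⁺ʳ Vs₁ (∈-++⁺ˡ (∈-prefix W (subst (toℕ j ≤_) (sym (toℕ-fromℕ _)) (toℕ≤pred[n] j)))))
    ... | own i with toℕ i ≤? toℕ a
    ...   | yes i≤a = there (∈-++⁺ˡ (∈-prefix V (subst (toℕ i ≤_) (sym (toℕ-inject₁ a)) i≤a)))
    ...   | no i≰a = there (∈-++⁺ʳ Vs₁ (∈-++⁺ʳ Ws (∈-++⁺ˡ (∈-suffix V (≰⇒> i≰a)))))

    entry-step : (V (inject₁ a) , W fzero) ∈ steps tour
    entry-step = steps-++⁺ʳ {ys = Vs₁ ++ Ws ++ Vs₂ ++ t ∷ []} (s ∷ [])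
      (steps-++-join {xs = Vs₁} (prefix-last V _) (head-++ {xs = Ws} (prefix-head W _)))

    exit-step : (W (end (opposite σ)) , V (fsuc a)) ∈ steps tour
    exit-step = steps-++⁺ʳ {ys = Vs₁ ++ Ws ++ Vs₂ ++ t ∷ []} (s ∷ []) (steps-++⁺ʳ Vs₁
      (steps-++-join {xs = Ws} (prefix-last W _) (head-++ {xs = Vs₂} (suffix-head V (fsuc a)))))

    tour-last : last tour ≡ just t
    tour-last = last-++ {ys = Vs₁ ++ Ws ++ Vs₂ ++ t ∷ []} {xs = s ∷ []} (last-++ {xs = Vs₁}
                  (last-++ {ys = Vs₂ ++ t ∷ []} {xs = Ws} (last-++ {ys = t ∷ []} {xs = Vs₂} refl)))

    tour-induces : InducedHP E P′ tour
    tour-induces =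
        Linked-rank-Unique (tourRank σ a) (Linked.map rank-increasing tour-linked)
      , tour-covers , refl , tour-last , Linked⇒steps tour-linked , entry-step ∷ exit-step ∷ []

    completion : IsAcyclicHPCompletion E P′
    completion =
        ((λ eq → side≢opposite σ (cong proj₁ eq)) ∷ []) ∷ [] ∷ []
      , no-edge-across σ _ _ ∷ no-edge-back σ _ _ ∷ []
      , (λ v cycle → <-irrefl refl (⁺-rank (tourRank σ a) rank-increasing cycle))
      , tour , tour-induces

  P′-crossings-≤ : ∀ σ a {b c P} → Unique P →
    (side σ (inject₁ a) , side (opposite σ) fzero) ∈ P →
    (side (opposite σ) b , side σ (fsuc a)) ∈ P →
    (side (opposite σ) (end (opposite σ)) , side σ c) ∈ P →
    crossings E (TwoEdges.P′ σ a) ≤ crossings E P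
  P′-crossings-≤ σ a {b} {c} {P} P-unique entry return exit with b ≟ᶠ end (opposite σ)
  ... | yes refl = sum-map-mono (edgeCrossings E) ((side≢opposite σ ∘ cong proj₁ ∷ []) ∷ [] ∷ []) P′⊆P
    where
    P′⊆P : TwoEdges.P′ σ a ⊆ P
    P′⊆P (here refl) = entry
    P′⊆P (there (here refl)) = return
  ... | no b≢end = begin
    cr e₁ + (cr e₂′ + 0)              ≤⟨ +-monoʳ-≤ (cr e₁) (+-monoˡ-≤ 0 triangle) ⟩
    cr e₁ + (cr e₃ + cr e₂ + 0)       ≡⟨ cong (cr e₁ +_) (+-assoc (cr e₃) (cr e₂) 0) ⟩
    crossings E (e₁ ∷ e₃ ∷ e₂ ∷ [])   ≤⟨ sum-map-mono cr distinct ⊆P ⟩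
    crossings E P                     ∎
    where
    open ≤-Reasoning
    cr : Edge m n → ℕ
    cr = edgeCrossings E
    e₁ e₂ e₃ e₂′ : Edge m n
    e₁ = side σ (inject₁ a) , side (opposite σ) fzero
    e₂ = side (opposite σ) (end (opposite σ)) , side σ c
    e₃ = side (opposite σ) b , side σ (fsuc a)
    e₂′ = side (opposite σ) (end (opposite σ)) , side σ (fsuc a)

    keeps : ∀ {f} → f ∈ E → Unseparated f (side (opposite σ) (end (opposite σ))) (side (opposite σ) b)
                              ⊎ Unseparated f (side σ (fsuc a)) (side σ c)
    keeps {u , w} f∈E with edge-keeps-side f∈E
    ... | τ , unseparated with side-cases σ τ
    ...   | inj₁ refl = inj₂ (unseparated _ _)
    ...   | inj₂ refl = inj₁ (unseparated _ _)

    triangle : cr e₂′ ≤ cr e₃ + cr e₂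
    triangle = edgeCrossings-triangle {w = proj₁ e₂} {proj₁ e₃} {proj₂ e₃} {proj₂ e₂} keeps

    ⊆P : (e₁ ∷ e₃ ∷ e₂ ∷ []) ⊆ P
    ⊆P (here refl) = entry
    ⊆P (there (here refl)) = return
    ⊆P (there (there (here refl))) = exit

    distinct : Unique (e₁ ∷ e₃ ∷ e₂ ∷ [])
    distinct = ((side≢opposite σ ∘ cong proj₁) ∷ (side≢opposite σ ∘ cong proj₁) ∷ [])
             ∷ ((λ eq → b≢end (side-injective (opposite σ) (cong proj₁ eq))) ∷ [])
             ∷ [] ∷ []

  end-steps : ∀ {Q ρ} σ {i c} → Acyclic (E ++ Q) → InducedHP E Q ρ →
    (side σ i , side (opposite σ) fzero) ∈ Q → (side (opposite σ) (end (opposite σ)) , side σ c) ∈ Q →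
    head (steps ρ) ≡ just (s , side σ fzero) × last (steps ρ) ≡ just (side σ (end σ) , t)
  end-steps σ acyclic hp entry exit =
    head-steps π-unique π-head (first-step-forced σ entry) , last-steps π-unique π-last (last-step-forced σ exit)
    where open Path acyclic hp

  module _ {P : List (Edge m n)} (P-unique : Unique P) (acyclic : Acyclic (E ++ P))
           {π : List (Vtx m n)} (hp : InducedHP E P π) where

    open Path acyclic hp

    two-edge-completion : ∀ σ → (s , side σ fzero) ∈ steps π → (side σ (end σ) , t) ∈ steps π →
      ∃[ P′ ] (IsAcyclicHPCompletion E P′ × length P′ ≡ 2 × crossings E P′ ≤ crossings E P × SameEndSteps E P P′)
    two-edge-completion σ first final with EndsOn.entry-edge σ first final | EndsOn.exit-edge σ first final
    ... | a , entry | c , exit with EndsOn.return-edge σ first final a entry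
    ... | b , return = P′ , completion , refl , P′-crossings-≤ σ a P-unique entry return exit , same-ends
      where
      open TwoEdges σ a
      same-ends : SameEndSteps E P P′
      same-ends π₁ π₂ h₁ h₂ with end-steps σ acyclic h₁ entry exit
                                | end-steps σ (proj₁ (proj₂ (proj₂ completion))) h₂ (here refl) (there (here refl))
      ... | head₁ , last₁ | head₂ , last₂ = trans head₁ (sym head₂) , trans last₁ (sym last₂)

  even-completion⇒two-edge-completion : ∀ {P} → IsAcyclicHPCompletion E P → odd (length P) ≡ false →
    ∃[ P′ ] (IsAcyclicHPCompletion E P′ × length P′ ≡ 2 × crossings E P′ ≤ crossings E P × SameEndSteps E P P′)
  even-completion⇒two-edge-completion (P-unique , P∉E , acyclic , π , hp) even
    with Path.first-step acyclic hp | Path.last-step acyclic hp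
  ... | σ , first | τ , final
    with refl ← isRight-injective σ τ (trans (sym (Path.odd-length-P acyclic hp P-unique P∉E first final)) even)
    = two-edge-completion P-unique acyclic hp σ first final

lemma6 : ∀ (m n : ℕ) (E : List (Edge m n)) → IsStPolygon m n E →
         ∀ (P : List (Edge m n)) (μ : ℕ) → 1 ≤ μ →
         IsAcyclicHPCompletion E P → length P ≡ 2 * μ →
         ∃[ P′ ] ( IsAcyclicHPCompletion E P′
                 × length P′ ≡ 2
                 × crossings E P′ ≤ crossings E P
                 × (∀ π π′ → InducedHP E P π → InducedHP E P′ π′ →
                      head (steps π) ≡ head (steps π′)
                      × last (steps π) ≡ last (steps π′)) )
lemma6 m n E poly P μ _ completion |P|≡2μ =
  Polygon.even-completion⇒two-edge-completion poly completion (trans (cong odd |P|≡2μ) (odd-2* μ))
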